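{- Let $k,l\in\mathbb{N}$, let $H_0$ be an infinite pairwise prime subset of $\mathbb{N}$, and let $A$ be an $l$-syndetic set. If $A$ has a pairwise prime subset $B$ with $|B|\ge l$, then $A\in\mathcal{S}_{k,l,H_0}$, i.e. $A$ contains a set of the form $\{x, x n^k r\}$ with $x,r\in\mathbb{N}$, $n\in H_0$ and $r\equiv 1\pmod n$.
   Context: $\mathbb{N}=\{1,2,3,\dots\}$. A set $A\subset\mathbb{N}$ is $l$-syndetic if it meets every set of $l$ consecutive natural numbers. A set $B\subset\mathbb{N}$ is pairwise prime if $\gcd(a,b)=1$ for all distinct $a,b\in B$. For $k,l\in\mathbb{N}$ and $H\subset\mathbb{N}$, $\mathcal{S}_{k,l,H}$ denotes the collection of $l$-syndetic sets that contain a set of the form $\{x, x n^k r\}$ with $x\in\mathbb{N}$, $n\in H$, $r\in\mathbb{N}$ and $r\equiv 1\pmod n$. -}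

module Defs where

open import Data.Nat using (ℕ; zero; suc; _+_; _*_; _^_; _≤_; _<_)
open import Data.Nat.Coprimality using (Coprime)
open import Data.Nat.DivMod using (_%_)
open import Data.Fin using (Fin)
open import Data.Product using (Σ; ∃; _×_; _,_)
open import Relation.Binary.PropositionalEquality using (_≡_; _≢_)

-- Subsets of ℕ are predicates.  The paper's ℕ = {1,2,3,...}; we use Agda's ℕ
-- and require positivity explicitly where needed.
Subset : Set₁
Subset = ℕ → Set

Positive : Subset → Set
Positive A = ∀ a → A a → 1 ≤ a

Syndetic : ℕ → Subset → Set
Syndetic l A = ∀ m → 1 ≤ m → ∃ λ i → i < l × A (m + i)

PairwisePrime : Subset → Set
PairwisePrime B = ∀ a b → B a → B b → a ≢ b → Coprime a b

Infinite : Subset → Set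
Infinite H = ∀ m → ∃ λ n → m < n × H n

_≡1mod_ : ℕ → ℕ → Set
r ≡1mod n = ∃ λ q → r ≡ 1 + q * n

ContainsPattern : ℕ → Subset → Subset → Set
ContainsPattern k H A =
  ∃ λ x → ∃ λ n → ∃ λ r →
    1 ≤ x × 1 ≤ r × H n × r ≡1mod n × A x × A (x * n ^ k * r)

𝒮 : ℕ → ℕ → Subset → Subset → Set
𝒮 k l H A = Syndetic l A × ContainsPattern k H A

module Submission where

-- Let b₀,…,b_{l-1} be the given pairwise coprime elements of A.
-- Pick distinct n₀,…,n_{l-1} ∈ H₀, each coprime to P = ∏ bᵢ (possible since
-- H₀ is infinite and pairwise prime: an element of H₀ sharing a factor d > 1
-- with P can be skipped, recursing on P / d).  The moduli
-- Nᵢ = bᵢ nᵢ^(k+1) are then pairwise coprime, so by the Chinese remainder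
-- theorem there is s with s + i ≡ bᵢ nᵢ^k (mod Nᵢ) for every i < l; adding
-- Q = ∏ Nᵢ to s keeps these congruences and makes m = Q + s large.  Since A
-- is l-syndetic, m + i ∈ A for some i < l, and m + i ≥ bᵢ nᵢ^k together with
-- the congruence gives m + i = bᵢ nᵢ^k (1 + q nᵢ): the pattern {x, x n^k r}
-- with x = bᵢ, n = nᵢ, r = 1 + q nᵢ.

open import Defs
open import Data.Nat using (ℕ; zero; suc; _+_; _*_; _^_; _≤_; _<_; z≤n; s≤s; >-nonZero)
open import Data.Nat.Properties
open import Data.Nat.Divisibility using (_∣_; divides; ∣-trans; m∣m*n; n∣m*n; ∣⇒≤)
open import Data.Nat.Coprimality using (Coprime; coprime?; coprime-Bézout; coprime-divisor; gcd≡1⇒coprime; 1-coprimeTo)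
  renaming (sym to coprime-sym)
open import Data.Nat.GCD using (gcd; gcd[m,n]∣m; gcd[m,n]∣n; module Bézout)
open import Data.Nat.Induction using (<-wellFounded)
open import Data.Nat.Tactic.RingSolver using (solve)
open import Induction.WellFounded using (Acc; acc)
open import Data.Fin using (Fin; zero; suc; toℕ; fromℕ<)
open import Data.Fin.Properties using (toℕ-injective; toℕ-fromℕ<) renaming (suc-injective to Fin-suc-injective)
open import Data.List using ([]; _∷_)
open import Data.Product using (∃; ∃₂; _×_; _,_; proj₁; proj₂)
open import Data.Sum using (inj₁; inj₂)
open import Data.Empty using (⊥-elim)
open import Function using (_∘_)
open import Function.Definitions using (Injective)
open import Relation.Nullary using (yes; no)
open import Relation.Binary.Definitions using (tri<; tri≈; tri>)
open import Relation.Binary.PropositionalEquality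
open ≡-Reasoning

infix 4 _≡_mod_
_≡_mod_ : ℕ → ℕ → ℕ → Set
_≡_mod_ a b N = ∃₂ λ q₁ q₂ → a + q₁ * N ≡ b + q₂ * N

mod-reflexive : ∀ {a b N} → a ≡ b → a ≡ b mod N
mod-reflexive refl = 0 , 0 , refl

mod-trans : ∀ {a b c N} → a ≡ b mod N → b ≡ c mod N → a ≡ c mod N
mod-trans {a} {b} {c} {N} (q₁ , q₂ , ab) (r₁ , r₂ , bc) = q₁ + r₁ , q₂ + r₂ , (begin
  a + (q₁ + r₁) * N       ≡⟨ solve (a ∷ q₁ ∷ r₁ ∷ N ∷ []) ⟩
  (a + q₁ * N) + r₁ * N   ≡⟨ cong (_+ r₁ * N) ab ⟩
  (b + q₂ * N) + r₁ * N   ≡⟨ solve (b ∷ q₂ ∷ r₁ ∷ N ∷ []) ⟩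
  (b + r₁ * N) + q₂ * N   ≡⟨ cong (_+ q₂ * N) bc ⟩
  (c + r₂ * N) + q₂ * N   ≡⟨ solve (c ∷ r₂ ∷ q₂ ∷ N ∷ []) ⟩
  c + (q₂ + r₂) * N       ∎)

mod-+ʳ : ∀ {a b N} w → a ≡ b mod N → a + w ≡ b + w mod N
mod-+ʳ {a} {b} {N} w (q₁ , q₂ , ab) = q₁ , q₂ , (begin
  a + w + q₁ * N   ≡⟨ solve (a ∷ w ∷ q₁ ∷ N ∷ []) ⟩
  a + q₁ * N + w   ≡⟨ cong (_+ w) ab ⟩
  b + q₂ * N + w   ≡⟨ solve (b ∷ q₂ ∷ N ∷ w ∷ []) ⟩
  b + w + q₂ * N   ∎)

mod-*ʳ : ∀ {a b N} w → a ≡ b mod N → a * w ≡ b * w mod N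
mod-*ʳ {a} {b} {N} w (q₁ , q₂ , ab) = q₁ * w , q₂ * w , (begin
  a * w + q₁ * w * N   ≡⟨ solve (a ∷ w ∷ q₁ ∷ N ∷ []) ⟩
  (a + q₁ * N) * w     ≡⟨ cong (_* w) ab ⟩
  (b + q₂ * N) * w     ≡⟨ solve (b ∷ q₂ ∷ N ∷ w ∷ []) ⟩
  b * w + q₂ * w * N   ∎)

mod-absorb : ∀ {M N} a → N ∣ M → M + a ≡ a mod N
mod-absorb {N = N} a (divides K refl) = 0 , K , (begin
  K * N + a + 0 * N   ≡⟨ solve (K ∷ N ∷ a ∷ []) ⟩
  a + K * N           ∎)

mod-lift : ∀ {a b N} → a ≡ b mod N → b ≤ a → ∃ λ q → a ≡ b + q * N
mod-lift {a} {b} {N} (q₁ , q₂ , ab) b≤a with ≤-total q₁ q₂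
... | inj₁ q₁≤q₂ with m≤n⇒∃[o]m+o≡n q₁≤q₂
...   | e , refl = e , +-cancelʳ-≡ (q₁ * N) a (b + e * N) (begin
  a + q₁ * N            ≡⟨ ab ⟩
  b + (q₁ + e) * N      ≡⟨ solve (b ∷ q₁ ∷ e ∷ N ∷ []) ⟩
  b + e * N + q₁ * N    ∎)
mod-lift {a} {b} {N} (q₁ , q₂ , ab) b≤a | inj₂ q₂≤q₁ with m≤n⇒∃[o]m+o≡n q₂≤q₁
...   | e , refl = 0 , trans (≤-antisym a≤b b≤a) (sym (+-identityʳ b))
  where
  a+eN≡b : a + e * N ≡ b
  a+eN≡b = +-cancelʳ-≡ (q₂ * N) (a + e * N) b (begin
    a + e * N + q₂ * N    ≡⟨ solve (a ∷ e ∷ q₂ ∷ N ∷ []) ⟩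
    a + (q₂ + e) * N      ≡⟨ ab ⟩
    b + q₂ * N            ∎)
  a≤b : a ≤ b
  a≤b = ≤-trans (m≤m+n a (e * N)) (≤-reflexive a+eN≡b)

mod-inverse : ∀ {M N} → 1 ≤ N → Coprime M N → ∃ λ u → M * u ≡ 1 mod N
mod-inverse {M} {suc N'} _ cop with coprime-Bézout cop
... | Bézout.+- x y 1+yN≡xM = x , 0 , y , (begin
  M * x + 0 * suc N'   ≡⟨ solve (M ∷ x ∷ N' ∷ []) ⟩
  x * M                ≡⟨ sym 1+yN≡xM ⟩
  1 + y * suc N'       ∎)
... | Bézout.-+ x y 1+xM≡yN = x * N' , 1 , y * N' , (begin
  M * (x * N') + 1 * suc N'   ≡⟨ solve (M ∷ x ∷ N' ∷ []) ⟩
  1 + (1 + x * M) * N'        ≡⟨ cong (λ z → 1 + z * N') 1+xM≡yN ⟩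
  1 + y * suc N' * N'         ≡⟨ solve (y ∷ N' ∷ []) ⟩
  1 + y * N' * suc N'         ∎)

mod-solve : ∀ {M N} → 1 ≤ N → Coprime M N → ∀ s c → ∃ λ t → M * t + s ≡ c mod N
mod-solve {M} {N@(suc N')} 1≤N cop s c with mod-inverse 1≤N cop
... | u , Mu≡1 = u * w , mod-trans regroup (mod-trans invert cancel)
  where
  -- w is chosen so that w + s = c + N s.
  w : ℕ
  w = c + N' * s
  regroup : M * (u * w) + s ≡ M * u * w + s mod N
  regroup = mod-reflexive (cong (_+ s) (sym (*-assoc M u w)))
  invert : M * u * w + s ≡ w + s mod N
  invert = subst (λ z → M * u * w + s ≡ z + s mod N) (*-identityˡ w) (mod-+ʳ s (mod-*ʳ w Mu≡1))
  cancel : w + s ≡ c mod N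
  cancel = mod-trans (mod-reflexive w+s≡Ns+c) (mod-absorb c (m∣m*n s))
    where
    w+s≡Ns+c : c + N' * s + s ≡ N * s + c
    w+s≡Ns+c = solve (c ∷ N' ∷ s ∷ [])

∏ : ∀ {l} → (Fin l → ℕ) → ℕ
∏ {zero}  g = 1
∏ {suc l} g = g zero * ∏ (g ∘ suc)

∣∏ : ∀ {l} (g : Fin l → ℕ) i → g i ∣ ∏ g
∣∏ g zero    = m∣m*n _
∣∏ g (suc i) = ∣-trans (∣∏ (g ∘ suc) i) (n∣m*n (g zero))

∏-positive : ∀ {l} (g : Fin l → ℕ) → (∀ i → 1 ≤ g i) → 1 ≤ ∏ g
∏-positive {zero}  g pos = ≤-refl
∏-positive {suc l} g pos = *-mono-≤ (pos zero) (∏-positive (g ∘ suc) (pos ∘ suc))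

coprime-*ʳ : ∀ {a b c} → Coprime a b → Coprime a c → Coprime a (b * c)
coprime-*ʳ a⊥b a⊥c (d∣a , d∣bc) =
  a⊥c (d∣a , coprime-divisor (λ (e∣d , e∣b) → a⊥b (∣-trans e∣d d∣a , e∣b)) d∣bc)

coprime-^ʳ : ∀ {a b} e → Coprime a b → Coprime a (b ^ e)
coprime-^ʳ zero    a⊥b = coprime-sym (1-coprimeTo _)
coprime-^ʳ (suc e) a⊥b = coprime-*ʳ a⊥b (coprime-^ʳ e a⊥b)

coprime-∣ʳ : ∀ {a b d} → Coprime a b → d ∣ b → Coprime a d
coprime-∣ʳ a⊥b d∣b (e∣a , e∣d) = a⊥b (e∣a , ∣-trans e∣d d∣b)

coprime-∏ : ∀ {a l} (g : Fin l → ℕ) → (∀ i → Coprime a (g i)) → Coprime a (∏ g)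
coprime-∏ {l = zero}  g a⊥g = coprime-sym (1-coprimeTo _)
coprime-∏ {l = suc l} g a⊥g = coprime-*ʳ (a⊥g zero) (coprime-∏ (g ∘ suc) (a⊥g ∘ suc))

coprime-monomialʳ : ∀ {a c d} e → Coprime a c → Coprime a d → Coprime a (c * d ^ e * d)
coprime-monomialʳ e a⊥c a⊥d = coprime-*ʳ (coprime-*ʳ a⊥c (coprime-^ʳ e a⊥d)) a⊥d

coprime-monomial : ∀ {a b c d} e → Coprime a c → Coprime a d → Coprime b c → Coprime b d →
                   Coprime (a * b ^ e * b) (c * d ^ e * d)
coprime-monomial e a⊥c a⊥d b⊥c b⊥d = coprime-sym
  (coprime-monomialʳ e (coprime-sym (coprime-monomialʳ e a⊥c a⊥d))
                       (coprime-sym (coprime-monomialʳ e b⊥c b⊥d)))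

PairwiseCoprime : ∀ {l} → (Fin l → ℕ) → Set
PairwiseCoprime N = ∀ i j → i ≢ j → Coprime (N i) (N j)

crt : ∀ {l} (N : Fin l → ℕ) → (∀ i → 1 ≤ N i) → PairwiseCoprime N →
      (c d : Fin l → ℕ) → ∃ λ s → ∀ i → s + d i ≡ c i mod N i
crt {zero}  N pos N-coprime c d = 0 , λ ()
crt {suc l} N pos N-coprime c d =
  let (s₀ , solves-tail) = crt (N ∘ suc) (pos ∘ suc) tail-coprime (c ∘ suc) (d ∘ suc)
      (t , solves-head)  = mod-solve (pos zero) M⊥N₀ (s₀ + d zero) (c zero)
      -- the new solution M t + s₀ still solves the tail, since every N (suc i) divides M
      reassociate : ∀ i → M * t + s₀ + d i ≡ M * t + (s₀ + d i) mod N i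
      reassociate i = mod-reflexive (+-assoc (M * t) s₀ (d i))
  in M * t + s₀ , λ where
       zero    → mod-trans (reassociate zero) solves-head
       (suc i) → mod-trans (reassociate (suc i))
                   (mod-trans (mod-absorb (s₀ + d (suc i)) (∣-trans (∣∏ (N ∘ suc) i) (m∣m*n t)))
                              (solves-tail i))
  where
  M : ℕ
  M = ∏ (N ∘ suc)
  tail-coprime : PairwiseCoprime (N ∘ suc)
  tail-coprime i j i≢j = N-coprime (suc i) (suc j) (i≢j ∘ Fin-suc-injective)
  M⊥N₀ : Coprime M (N zero)
  M⊥N₀ = coprime-sym (coprime-∏ (N ∘ suc) (λ i → N-coprime zero (suc i) (λ ())))

proper-factor : ∀ P' d → 1 ≤ P' * d → d ≢ 1 → 1 ≤ P' × P' < P' * d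
proper-factor P'            zero          pos _ with subst (1 ≤_) (*-zeroʳ P') pos
... | ()
proper-factor P'            (suc zero)    _   d≢1 = ⊥-elim (d≢1 refl)
proper-factor (suc p)       (suc (suc e)) _   _   = s≤s z≤n , m<m*n (suc p) (suc (suc e)) (s≤s (s≤s z≤n))

-- Above every bound an infinite pairwise prime set H has an element coprime
-- to a given positive P: if h ∈ H shares the factor d = gcd h P ≠ 1 with P,
-- an element n > h of H coprime to P / d is coprime to d as well (n ⊥ h).
coprime-element-above : ∀ {H} → Infinite H → PairwisePrime H →
                        ∀ P → 1 ≤ P → ∀ bound → ∃ λ n → bound < n × H n × Coprime n P
coprime-element-above {H} H-infinite H-pairwise P = go P (<-wellFounded P)
  where
  go : ∀ P → Acc _<_ P → 1 ≤ P → ∀ bound → ∃ λ n → bound < n × H n × Coprime n P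
  go P (acc smaller) 1≤P bound with H-infinite bound
  ... | h , bound<h , h∈H with coprime? h P
  ...   | yes h⊥P = h , bound<h , h∈H , h⊥P
  ...   | no ¬h⊥P with gcd[m,n]∣n h P
  ...     | divides P' P≡P'd =
    let d = gcd h P
        (1≤P' , P'<P) = proper-factor P' d (subst (1 ≤_) P≡P'd 1≤P) (¬h⊥P ∘ gcd≡1⇒coprime)
        (n , h<n , n∈H , n⊥P') = go P' (smaller (subst (P' <_) (sym P≡P'd) P'<P)) 1≤P' h
        n⊥d = coprime-∣ʳ (H-pairwise n h n∈H h∈H (>⇒≢ h<n)) (gcd[m,n]∣m h P)
    in n , <-trans bound<h h<n , n∈H , subst (Coprime n) (sym P≡P'd) (coprime-*ʳ n⊥P' n⊥d)

increasing⇒strictly-monotone : (g : ℕ → ℕ) → (∀ j → g j < g (suc j)) → ∀ {i j} → i < j → g i < g j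
increasing⇒strictly-monotone g step {j = suc j} (s≤s i≤j) with m≤n⇒m<n∨m≡n i≤j
... | inj₁ i<j  = <-trans (increasing⇒strictly-monotone g step i<j) (step j)
... | inj₂ refl = step j

increasing⇒injective : (g : ℕ → ℕ) → (∀ j → g j < g (suc j)) → Injective _≡_ _≡_ g
increasing⇒injective g step {i} {j} gi≡gj with <-cmp i j
... | tri< i<j _ _ = ⊥-elim (<⇒≢ (increasing⇒strictly-monotone g step i<j) gi≡gj)
... | tri≈ _ i≡j _ = i≡j
... | tri> _ _ j<i = ⊥-elim (>⇒≢ (increasing⇒strictly-monotone g step j<i) gi≡gj)

unbounded⇒enumeration : {Q : ℕ → Set} → (∀ bound → ∃ λ n → bound < n × Q n) →
                        ∃ λ (g : ℕ → ℕ) → Injective _≡_ _≡_ g × (∀ j → Q (g j))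
unbounded⇒enumeration {Q} above =
  g , increasing⇒injective g (λ j → proj₁ (proj₂ (above (g j)))) , (λ j → proj₂ (proj₂ (above (bound j))))
  where
  bound g : ℕ → ℕ
  bound zero    = 0
  bound (suc j) = g j
  g j = proj₁ (above (bound j))

choose-multipliers : ∀ {H l} → Infinite H → PairwisePrime H → (b : Fin l → ℕ) → 1 ≤ ∏ b →
  ∃ λ (n : Fin l → ℕ) → (∀ i → H (n i)) × PairwiseCoprime n × (∀ i j → Coprime (n i) (b j))
choose-multipliers {H} H-infinite H-pairwise b ∏b-pos =
  let (g , g-injective , g-good) =
        unbounded⇒enumeration (coprime-element-above H-infinite H-pairwise (∏ b) ∏b-pos)
      n∈H : ∀ i → H (g (toℕ i))
      n∈H i = proj₁ (g-good (toℕ i))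
  in g ∘ toℕ ,
     n∈H ,
     (λ i j i≢j → H-pairwise _ _ (n∈H i) (n∈H j) (i≢j ∘ toℕ-injective ∘ g-injective)) ,
     (λ i j → coprime-∣ʳ (proj₂ (g-good (toℕ i))) (∣∏ b j))

congruence-pattern : ∀ {x c n} → x ≡ c mod c * n → c ≤ x → ∃ λ q → x ≡ c * (1 + q * n)
congruence-pattern {x} {c} {n} x≡c c≤x =
  let (q , x≡c+qcn) = mod-lift x≡c c≤x in q , trans x≡c+qcn (factor q)
  where
  factor : ∀ q → c + q * (c * n) ≡ c * (1 + q * n)
  factor q = solve (c ∷ q ∷ n ∷ [])

syndetic-window : ∀ {l A} → Syndetic l A → ∀ m → 1 ≤ m → ∃ λ (j : Fin l) → A (m + toℕ j)
syndetic-window {A = A} A-syndetic m 1≤m =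
  let (i , i<l , m+i∈A) = A-syndetic m 1≤m
  in fromℕ< i<l , subst (λ z → A (m + z)) (sym (toℕ-fromℕ< i<l)) m+i∈A

-- The core argument: with cᵢ = bᵢ nᵢ^k and Nᵢ = cᵢ nᵢ pairwise coprime, solve
-- s + i ≡ cᵢ (mod Nᵢ); the window starting at m = ∏ N + s contains some
-- m + j ∈ A, and m + j ≥ cⱼ forces m + j = cⱼ (1 + q nⱼ).
syndetic-contains-pattern : ∀ {k l H A} → Syndetic l A →
  (b n : Fin l → ℕ) → (∀ i → A (b i)) → (∀ i → 1 ≤ b i) → PairwiseCoprime b →
  (∀ i → H (n i)) → (∀ i → 1 ≤ n i) → PairwiseCoprime n → (∀ i j → Coprime (n i) (b j)) →
  ContainsPattern k H A
syndetic-contains-pattern {k} {l} {H} {A} A-syndetic b n b∈A b-pos b-coprime n∈H n-pos n-coprime n⊥b =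
  let (s , s-solves) = crt N N-pos N-coprime c toℕ
      m = Q + s
      (j , m+j∈A) = syndetic-window {A = A} A-syndetic m (≤-trans Q-pos (m≤m+n Q s))
      m+j≡c : m + toℕ j ≡ c j mod N j
      m+j≡c = mod-trans (mod-reflexive (+-assoc Q s (toℕ j)))
                (mod-trans (mod-absorb (s + toℕ j) (∣∏ N j)) (s-solves j))
      c≤m+j : c j ≤ m + toℕ j
      c≤m+j = ≤-trans (c≤N j) (≤-trans (N≤Q j) (≤-trans (m≤m+n Q s) (m≤m+n m (toℕ j))))
      (q , m+j≡c[1+qn]) = congruence-pattern m+j≡c c≤m+j
  in b j , n j , 1 + q * n j , b-pos j , s≤s z≤n , n∈H j , (q , refl) , b∈A j ,
     subst A m+j≡c[1+qn] m+j∈A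
  where
  c N : Fin l → ℕ
  c i = b i * n i ^ k
  N i = c i * n i
  N-pos : ∀ i → 1 ≤ N i
  N-pos i = *-mono-≤ (*-mono-≤ (b-pos i) (m^n>0 (n i) {{>-nonZero (n-pos i)}} k)) (n-pos i)
  N-coprime : PairwiseCoprime N
  N-coprime i j i≢j = coprime-monomial k (b-coprime i j i≢j) (coprime-sym (n⊥b j i))
                                         (n⊥b i j) (n-coprime i j i≢j)
  Q : ℕ
  Q = ∏ N
  Q-pos : 1 ≤ Q
  Q-pos = ∏-positive N N-pos
  c≤N : ∀ i → c i ≤ N i
  c≤N i = m≤m*n (c i) (n i) {{>-nonZero (n-pos i)}}
  N≤Q : ∀ i → N i ≤ Q
  N≤Q i = ∣⇒≤ {{>-nonZero Q-pos}} (∣∏ N i)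

-- Proposition 2.4.

proposition2p4 : (k l : ℕ) → 1 ≤ k → 1 ≤ l →
    (H₀ : Subset) → Positive H₀ → Infinite H₀ → PairwisePrime H₀ →
    (A : Subset) → Positive A → Syndetic l A →
    (B : Subset) → (∀ b → B b → A b) → PairwisePrime B →
    (f : Fin l → ℕ) → Injective _≡_ _≡_ f → (∀ i → B (f i)) →
    𝒮 k l H₀ A
proposition2p4 k l _ _ H₀ H₀-pos H₀-infinite H₀-pairwise A A-pos A-syndetic B B⊆A B-pairwise b b-injective b∈B =
  let (n , n∈H₀ , n-coprime , n⊥b) = choose-multipliers H₀-infinite H₀-pairwise b (∏-positive b b-pos)
  in A-syndetic ,
     syndetic-contains-pattern {k = k} A-syndetic b n b∈A b-pos b-coprime
       n∈H₀ (λ i → H₀-pos _ (n∈H₀ i)) n-coprime n⊥b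
  where
  b∈A : ∀ i → A (b i)
  b∈A i = B⊆A _ (b∈B i)
  b-pos : ∀ i → 1 ≤ b i
  b-pos i = A-pos _ (b∈A i)
  b-coprime : PairwiseCoprime b
  b-coprime i j i≢j = B-pairwise _ _ (b∈B i) (b∈B j) (i≢j ∘ b-injective)
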